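{- Let $\mathbf A$ be a finite algebra, $\rho\in\operatorname{Con}(\mathbf A)\setminus\{1_A\}$, and $L\in\operatorname{Cov}(\rho)$. Then the set $\operatorname{ref.tr}(\rho,L)$ has a unique maximal member $\operatorname{Opt}(\rho,L)$, and $\rho\le\operatorname{Opt}(\rho,L)\in\operatorname{Con}(\mathbf A)$.
   Context: A bridge from $(\mathbf A,\rho)$ to $(\mathbf A,\rho)$ is a subuniverse $T\le\mathbf A^4$ such that (B0*) $T$ is closed under replacing any coordinate by a $\rho$-related element; (B1*) $\rho\subsetneq\operatorname{pr}_{1,2}(T)$ and $\rho\subsetneq\operatorname{pr}_{3,4}(T)$; (B2*) for all $(a_1,a_2,b_1,b_2)\in T$, $(a_1,a_2)\in\rho\iff(b_1,b_2)\in\rho$. It is a bridge from $(\mathbf A,\rho,L)$ to $(\mathbf A,\rho,L)$ if $\operatorname{pr}_{1,2}(T)=\operatorname{pr}_{3,4}(T)=L$. Its trace is $\operatorname{tr}(T)=\{(a,b):(a,a,b,b)\in T\}$; $T$ is reflexive if $0_A\subseteq\operatorname{tr}(T)$. A subuniverse $R\le\mathbf A^2$ is $\rho$-saturated if $R=\rho\circ R\circ\rho$; $\operatorname{Cov}(\rho)$ is the set of minimal (under inclusion) $\rho$-saturated subuniverses of $\mathbf A^2$ properly containing $\rho$. $\operatorname{ref.tr}(\rho,L)=\{\operatorname{tr}(T): T\text{ a reflexive bridge from }(\mathbf A,\rho,L)\text{ to }(\mathbf A,\rho,L)\}$. -}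

module Defs where

open import Data.Nat using (ℕ)
open import Data.Fin using (Fin)
open import Data.Unit using (⊤)
open import Data.Product using (Σ; ∃; ∃-syntax; _×_; _,_)
open import Function.Bundles using (_↔_)
open import Relation.Nullary using (¬_)
open import Level using (Level; suc; _⊔_) renaming (zero to lzero)

record Algebra : Set₁ where
  field
    Carrier : Set
    Op      : Set
    arity   : Op → ℕ
    ⟦_⟧     : (f : Op) → (Fin (arity f) → Carrier) → Carrier

record FiniteAlgebra : Set₁ where
  field
    algebra : Algebra
    size    : ℕ
    finite  : Algebra.Carrier algebra ↔ Fin size
  open Algebra algebra public

module _ (𝔸 : Algebra) where
  open Algebra 𝔸

  Rel₂ : Set₁
  Rel₂ = Carrier → Carrier → Set

  Rel₄ : Set₁
  Rel₄ = Carrier → Carrier → Carrier → Carrier → Set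

  IsSubuniverse₂ : Rel₂ → Set
  IsSubuniverse₂ R = (f : Op) (x y : Fin (arity f) → Carrier) →
    (∀ i → R (x i) (y i)) → R (⟦ f ⟧ x) (⟦ f ⟧ y)

  IsSubuniverse₄ : Rel₄ → Set
  IsSubuniverse₄ T = (f : Op) (x y z w : Fin (arity f) → Carrier) →
    (∀ i → T (x i) (y i) (z i) (w i)) →
    T (⟦ f ⟧ x) (⟦ f ⟧ y) (⟦ f ⟧ z) (⟦ f ⟧ w)

  _⊆_ : Rel₂ → Rel₂ → Set
  R ⊆ S = ∀ a b → R a b → S a b

  _≐_ : Rel₂ → Rel₂ → Set
  R ≐ S = (R ⊆ S) × (S ⊆ R)

  _⊂_ : Rel₂ → Rel₂ → Set
  R ⊂ S = (R ⊆ S) × ∃[ a ] ∃[ b ] (S a b × ¬ R a b)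

  _∘ᵣ_ : Rel₂ → Rel₂ → Rel₂
  (R ∘ᵣ S) a b = ∃[ c ] (R a c × S c b)

  record IsCongruence (θ : Rel₂) : Set where
    field
      refl'      : ∀ a → θ a a
      sym'       : ∀ a b → θ a b → θ b a
      trans'     : ∀ a b c → θ a b → θ b c → θ a c
      compatible : IsSubuniverse₂ θ

  full : Rel₂
  full _ _ = ⊤

  IsSaturated : Rel₂ → Rel₂ → Set
  IsSaturated ρ R = IsSubuniverse₂ R × (R ≐ (ρ ∘ᵣ (R ∘ᵣ ρ)))

  InCov : Rel₂ → Rel₂ → Set₁
  InCov ρ L = IsSaturated ρ L × (ρ ⊂ L) ×
    ((R : Rel₂) → IsSaturated ρ R → ρ ⊂ R → R ⊆ L → L ⊆ R)

  pr₁₂ : Rel₄ → Rel₂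
  pr₁₂ T a b = ∃[ c ] ∃[ d ] T a b c d

  pr₃₄ : Rel₄ → Rel₂
  pr₃₄ T c d = ∃[ a ] ∃[ b ] T a b c d

  tr : Rel₄ → Rel₂
  tr T a b = T a a b b

  record IsBridge (ρ : Rel₂) (T : Rel₄) : Set where
    field
      subuniverse : IsSubuniverse₄ T
      B0₁ : ∀ a₁ a₂ b₁ b₂ a → T a₁ a₂ b₁ b₂ → ρ a₁ a → T a a₂ b₁ b₂
      B0₂ : ∀ a₁ a₂ b₁ b₂ a → T a₁ a₂ b₁ b₂ → ρ a₂ a → T a₁ a b₁ b₂
      B0₃ : ∀ a₁ a₂ b₁ b₂ a → T a₁ a₂ b₁ b₂ → ρ b₁ a → T a₁ a₂ a b₂
      B0₄ : ∀ a₁ a₂ b₁ b₂ a → T a₁ a₂ b₁ b₂ → ρ b₂ a → T a₁ a₂ b₁ a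
      B1₁₂ : ρ ⊂ pr₁₂ T
      B1₃₄ : ρ ⊂ pr₃₄ T
      B2⇒ : ∀ a₁ a₂ b₁ b₂ → T a₁ a₂ b₁ b₂ → ρ a₁ a₂ → ρ b₁ b₂
      B2⇐ : ∀ a₁ a₂ b₁ b₂ → T a₁ a₂ b₁ b₂ → ρ b₁ b₂ → ρ a₁ a₂

  IsBridgeL : Rel₂ → Rel₂ → Rel₄ → Set
  IsBridgeL ρ L T = IsBridge ρ T × (pr₁₂ T ≐ L) × (pr₃₄ T ≐ L)

  IsReflexive : Rel₄ → Set
  IsReflexive T = ∀ a → tr T a a

  RefTr : Rel₂ → Rel₂ → Rel₂ → Set₁
  RefTr ρ L S = ∃[ T ] (IsBridgeL ρ L T × IsReflexive T × (S ≐ tr T))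

  IsMaximalIn : (Rel₂ → Set₁) → Rel₂ → Set₁
  IsMaximalIn X O = X O × ((S : Rel₂) → X S → O ⊆ S → S ⊆ O)

-- Take Opt to be the union of all reflexive traces; it suffices to show it is itself one.
-- If T is a reflexive bridge with (a,b) in its trace, then T ∘ Tᵀ is a bridge containing the
-- L-diagonal and (a,a,b,b), hence it contains the bridge closure of these tuples; so (a,b) lies
-- in a reflexive trace iff that closure is itself a bridge. The closure generated by all of Opt
-- is again a bridge: each of its tuples is derived from finitely many generators, and the
-- bridges witnessing them compose into a single bridge containing all of them. Its trace is
-- Opt, and the same composition/converse constructions show that Opt is a congruence above ρ.
module Submission where

open import Data.Fin using (Fin; zero; suc)
open import Data.Nat using (zero; suc)
open import Data.Product using (Σ; ∃-syntax; _×_; _,_; proj₁; proj₂)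
open import Function using (_∘_)
open import Relation.Binary.PropositionalEquality using (_≡_; refl)
open import Relation.Nullary using (¬_)

open import Defs

module Relations (A : Algebra) where

  ⊂-⊆-trans : {R S X : Rel₂ A} → _⊂_ A R S → _⊆_ A S X → _⊂_ A R X
  ⊂-⊆-trans (R⊆S , a , b , s , ¬r) S⊆X =
    (λ x y r → S⊆X x y (R⊆S x y r)) , a , b , S⊆X a b s , ¬r

  IsGreatestIn : (Rel₂ A → Set₁) → Rel₂ A → Set₁
  IsGreatestIn X O = X O × ((S : Rel₂ A) → X S → _⊆_ A S O)

  greatest⇒maximal : ∀ {X O} → IsGreatestIn X O → IsMaximalIn A X O
  greatest⇒maximal (O∈X , greatest) = O∈X , λ S S∈X _ → greatest S S∈X

  maximal≐greatest : ∀ {X O M} → IsGreatestIn X O → IsMaximalIn A X M → _≐_ A M O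
  maximal≐greatest (O∈X , greatest) (M∈X , maximal) =
    greatest _ M∈X , maximal _ O∈X (greatest _ M∈X)

module OptimalTrace (A : Algebra) (ρ : Rel₂ A) (ρ-congruence : IsCongruence A ρ)
                    (L : Rel₂ A) (L-saturated : IsSaturated A ρ L) (ρ⊂L : _⊂_ A ρ L) where
  open Algebra A
  open IsCongruence ρ-congruence
  open Relations A
  open IsBridge using (subuniverse; B0₁; B0₂; B0₃; B0₄; B2⇒; B2⇐)

  infix 4 _⊆₂_ _≐₂_ _⊆₄_
  infixl 6 _⨾_

  _⊆₂_ : Rel₂ A → Rel₂ A → Set
  _⊆₂_ = _⊆_ A

  _≐₂_ : Rel₂ A → Rel₂ A → Set
  _≐₂_ = _≐_ A

  _⊆₄_ : Rel₄ A → Rel₄ A → Set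
  T ⊆₄ U = ∀ {a b c d} → T a b c d → U a b c d

  ρ⊆L : ρ ⊆₂ L
  ρ⊆L = proj₁ ρ⊂L

  L-closed : ∀ {a b c d} → ρ a b → L b c → ρ c d → L a d
  L-closed {a} {b} {c} {d} r l r′ = proj₂ (proj₂ L-saturated) a d (b , r , c , l , r′)

  Bridge : Rel₄ A → Set
  Bridge = IsBridgeL A ρ L

  HasDiagonal : Rel₄ A → Set
  HasDiagonal U = ∀ x y → L x y → U x y x y

  DiagonalBridge : Rel₄ A → Set
  DiagonalBridge U = Bridge U × HasDiagonal U

  _⨾_ : Rel₄ A → Rel₄ A → Rel₄ A
  (T ⨾ U) a₁ a₂ c₁ c₂ = ∃[ b₁ ] ∃[ b₂ ] (T a₁ a₂ b₁ b₂ × U b₁ b₂ c₁ c₂)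

  _ᵀ : Rel₄ A → Rel₄ A
  (T ᵀ) a₁ a₂ b₁ b₂ = T b₁ b₂ a₁ a₂

  ⨾-bridge : ∀ {T U} → Bridge T → Bridge U → Bridge (T ⨾ U)
  ⨾-bridge {T} {U} (T-bridge , T₁₂ , T₃₄) (U-bridge , U₁₂ , U₃₄) = bridge , pr₁₂≐L , pr₃₄≐L
    where
    pr₁₂≐L : pr₁₂ A (T ⨾ U) ≐₂ L
    pr₁₂≐L = (λ { a b (_ , _ , b₁ , b₂ , t , _) → proj₁ T₁₂ a b (b₁ , b₂ , t) })
           , λ a b l → extend a b (proj₂ T₁₂ a b l)
      where
      extend : ∀ a b → pr₁₂ A T a b → pr₁₂ A (T ⨾ U) a b
      extend a b (b₁ , b₂ , t) with proj₂ U₁₂ b₁ b₂ (proj₁ T₃₄ b₁ b₂ (a , b , t))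
      ... | c₁ , c₂ , u = c₁ , c₂ , b₁ , b₂ , t , u

    pr₃₄≐L : pr₃₄ A (T ⨾ U) ≐₂ L
    pr₃₄≐L = (λ { c d (_ , _ , b₁ , b₂ , _ , u) → proj₁ U₃₄ c d (b₁ , b₂ , u) })
           , λ c d l → extend c d (proj₂ U₃₄ c d l)
      where
      extend : ∀ c d → pr₃₄ A U c d → pr₃₄ A (T ⨾ U) c d
      extend c d (b₁ , b₂ , u) with proj₂ T₃₄ b₁ b₂ (proj₁ U₁₂ b₁ b₂ (c , d , u))
      ... | a₁ , a₂ , t = a₁ , a₂ , b₁ , b₂ , t , u

    bridge : IsBridge A ρ (T ⨾ U)
    bridge = record
      { subuniverse = λ f x y z w h →
          ⟦ f ⟧ (proj₁ ∘ h) , ⟦ f ⟧ (proj₁ ∘ proj₂ ∘ h) ,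
          subuniverse T-bridge f x y _ _ (proj₁ ∘ proj₂ ∘ proj₂ ∘ h) ,
          subuniverse U-bridge f _ _ z w (proj₂ ∘ proj₂ ∘ proj₂ ∘ h)
      ; B0₁ = λ { _ _ _ _ a (b₁ , b₂ , t , u) r → b₁ , b₂ , B0₁ T-bridge _ _ _ _ a t r , u }
      ; B0₂ = λ { _ _ _ _ a (b₁ , b₂ , t , u) r → b₁ , b₂ , B0₂ T-bridge _ _ _ _ a t r , u }
      ; B0₃ = λ { _ _ _ _ a (b₁ , b₂ , t , u) r → b₁ , b₂ , t , B0₃ U-bridge _ _ _ _ a u r }
      ; B0₄ = λ { _ _ _ _ a (b₁ , b₂ , t , u) r → b₁ , b₂ , t , B0₄ U-bridge _ _ _ _ a u r }
      ; B1₁₂ = ⊂-⊆-trans ρ⊂L (proj₂ pr₁₂≐L)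
      ; B1₃₄ = ⊂-⊆-trans ρ⊂L (proj₂ pr₃₄≐L)
      ; B2⇒ = λ { _ _ _ _ (_ , _ , t , u) r → B2⇒ U-bridge _ _ _ _ u (B2⇒ T-bridge _ _ _ _ t r) }
      ; B2⇐ = λ { _ _ _ _ (_ , _ , t , u) r → B2⇐ T-bridge _ _ _ _ t (B2⇐ U-bridge _ _ _ _ u r) }
      }

  ᵀ-bridge : ∀ {T} → Bridge T → Bridge (T ᵀ)
  ᵀ-bridge (T-bridge , T₁₂ , T₃₄) = bridge , T₃₄ , T₁₂
    where
    bridge : IsBridge A ρ (_ ᵀ)
    bridge = record
      { subuniverse = λ f x y z w → subuniverse T-bridge f z w x y
      ; B0₁ = λ _ _ _ _ → B0₃ T-bridge _ _ _ _
      ; B0₂ = λ _ _ _ _ → B0₄ T-bridge _ _ _ _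
      ; B0₃ = λ _ _ _ _ → B0₁ T-bridge _ _ _ _
      ; B0₄ = λ _ _ _ _ → B0₂ T-bridge _ _ _ _
      ; B1₁₂ = IsBridge.B1₃₄ T-bridge
      ; B1₃₄ = IsBridge.B1₁₂ T-bridge
      ; B2⇒ = λ _ _ _ _ → B2⇐ T-bridge _ _ _ _
      ; B2⇐ = λ _ _ _ _ → B2⇒ T-bridge _ _ _ _
      }

  ⨾-reflexive : ∀ {T U} → IsReflexive A T → IsReflexive A U → IsReflexive A (T ⨾ U)
  ⨾-reflexive T-refl U-refl x = x , x , T-refl x , U-refl x

  tr-⨾ : ∀ {T U a b c} → tr A T a b → tr A U b c → tr A (T ⨾ U) a c
  tr-⨾ {b = b} t u = b , b , t , u

  ⨾-diagonal : ∀ {T U} → HasDiagonal T → HasDiagonal U → HasDiagonal (T ⨾ U)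
  ⨾-diagonal T-diag U-diag x y l = x , y , T-diag x y l , U-diag x y l

  ⨾ᵀ-diagonal : ∀ {T} → Bridge T → HasDiagonal (T ⨾ T ᵀ)
  ⨾ᵀ-diagonal (_ , T₁₂ , _) x y l with proj₂ T₁₂ x y l
  ... | b₁ , b₂ , t = b₁ , b₂ , t , t

  ⊆-⨾ˡ : ∀ {T U} → Bridge T → HasDiagonal U → T ⊆₄ T ⨾ U
  ⊆-⨾ˡ (_ , _ , T₃₄) U-diag {a} {b} {c} {d} t =
    c , d , t , U-diag c d (proj₁ T₃₄ c d (a , b , t))

  ⊆-⨾ʳ : ∀ {T U} → HasDiagonal T → Bridge U → U ⊆₄ T ⨾ U
  ⊆-⨾ʳ T-diag (_ , U₁₂ , _) {a} {b} {c} {d} u =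
    a , b , T-diag a b (proj₁ U₁₂ a b (c , d , u)) , u

  Canonical : Rel₄ A
  Canonical a₁ a₂ b₁ b₂ = L a₁ a₂ × ρ a₁ b₁ × ρ a₂ b₂

  canonical-diagonal : HasDiagonal Canonical
  canonical-diagonal x y l = l , refl' x , refl' y

  canonical-bridge : Bridge Canonical
  canonical-bridge = bridge , pr₁₂≐L , pr₃₄≐L
    where
    pr₁₂≐L : pr₁₂ A Canonical ≐₂ L
    pr₁₂≐L = (λ { _ _ (_ , _ , l , _) → l }) , λ a b l → a , b , canonical-diagonal a b l

    pr₃₄≐L : pr₃₄ A Canonical ≐₂ L
    pr₃₄≐L = (λ { c d (a , b , l , r₁ , r₂) → L-closed (sym' a c r₁) l r₂ })
           , λ a b l → a , b , canonical-diagonal a b l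

    bridge : IsBridge A ρ Canonical
    bridge = record
      { subuniverse = λ f x y z w h →
          proj₁ L-saturated f x y (proj₁ ∘ h) ,
          compatible f x z (proj₁ ∘ proj₂ ∘ h) ,
          compatible f y w (proj₂ ∘ proj₂ ∘ h)
      ; B0₁ = λ { a₁ a₂ b₁ b₂ a (l , r₁ , r₂) r →
          L-closed (sym' a₁ a r) l (refl' a₂) , trans' a a₁ b₁ (sym' a₁ a r) r₁ , r₂ }
      ; B0₂ = λ { a₁ a₂ b₁ b₂ a (l , r₁ , r₂) r →
          L-closed (refl' a₁) l r , r₁ , trans' a a₂ b₂ (sym' a₂ a r) r₂ }
      ; B0₃ = λ { a₁ a₂ b₁ b₂ a (l , r₁ , r₂) r → l , trans' a₁ b₁ a r₁ r , r₂ }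
      ; B0₄ = λ { a₁ a₂ b₁ b₂ a (l , r₁ , r₂) r → l , r₁ , trans' a₂ b₂ a r₂ r }
      ; B1₁₂ = ⊂-⊆-trans ρ⊂L (proj₂ pr₁₂≐L)
      ; B1₃₄ = ⊂-⊆-trans ρ⊂L (proj₂ pr₃₄≐L)
      ; B2⇒ = λ { a₁ a₂ b₁ b₂ (_ , r₁ , r₂) r →
          trans' b₁ a₁ b₂ (sym' a₁ b₁ r₁) (trans' a₁ a₂ b₂ r r₂) }
      ; B2⇐ = λ { a₁ a₂ b₁ b₂ (_ , r₁ , r₂) r →
          trans' a₁ b₁ a₂ r₁ (trans' b₁ b₂ a₂ r (sym' a₂ b₂ r₂)) }
      }

  canonical-reflexive : IsReflexive A Canonical
  canonical-reflexive a = canonical-diagonal a a (ρ⊆L a a (refl' a))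

  ρ⊆tr-canonical : ρ ⊆₂ tr A Canonical
  ρ⊆tr-canonical a b r = ρ⊆L a a (refl' a) , r , r

  common-diagonal-bridge : ∀ k (U : Fin k → Rel₄ A) → (∀ i → DiagonalBridge (U i)) →
    ∃[ V ] (DiagonalBridge V × (∀ i → U i ⊆₄ V))
  common-diagonal-bridge zero U _ =
    Canonical , (canonical-bridge , canonical-diagonal) , λ ()
  common-diagonal-bridge (suc k) U U-db
    with common-diagonal-bridge k (U ∘ suc) (U-db ∘ suc)
  ... | V , (V-bridge , V-diag) , U⊆V =
    U zero ⨾ V , (⨾-bridge U₀-bridge V-bridge , ⨾-diagonal U₀-diag V-diag) , U⊆U₀⨾V
    where
    U₀-bridge = proj₁ (U-db zero)
    U₀-diag = proj₂ (U-db zero)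

    U⊆U₀⨾V : ∀ i → U i ⊆₄ U zero ⨾ V
    U⊆U₀⨾V zero = ⊆-⨾ˡ U₀-bridge V-diag
    U⊆U₀⨾V (suc i) = ⊆-⨾ʳ U₀-diag V-bridge ∘ U⊆V i

  data Generated (S : Rel₂ A) : Rel₄ A where
    diagonal  : ∀ {x y} → L x y → Generated S x y x y
    generator : ∀ {x y} → S x y → Generated S x x y y
    apply     : ∀ f (x y z w : Fin (arity f) → Carrier) →
                (∀ i → Generated S (x i) (y i) (z i) (w i)) →
                Generated S (⟦ f ⟧ x) (⟦ f ⟧ y) (⟦ f ⟧ z) (⟦ f ⟧ w)
    replace₁  : ∀ {a₁ a₂ b₁ b₂} a → Generated S a₁ a₂ b₁ b₂ → ρ a₁ a → Generated S a a₂ b₁ b₂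
    replace₂  : ∀ {a₁ a₂ b₁ b₂} a → Generated S a₁ a₂ b₁ b₂ → ρ a₂ a → Generated S a₁ a b₁ b₂
    replace₃  : ∀ {a₁ a₂ b₁ b₂} a → Generated S a₁ a₂ b₁ b₂ → ρ b₁ a → Generated S a₁ a₂ a b₂
    replace₄  : ∀ {a₁ a₂ b₁ b₂} a → Generated S a₁ a₂ b₁ b₂ → ρ b₂ a → Generated S a₁ a₂ b₁ a

  Generated-reflexive : ∀ {S} → IsReflexive A (Generated S)
  Generated-reflexive x = diagonal (ρ⊆L x x (refl' x))

  Generated-least : ∀ {S U} → IsBridge A ρ U → HasDiagonal U → S ⊆₂ tr A U → Generated S ⊆₄ U
  Generated-least U-bridge U-diag S⊆trU = go
    where
    go : Generated _ ⊆₄ _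
    go (diagonal l)        = U-diag _ _ l
    go (generator s)       = S⊆trU _ _ s
    go (apply f x y z w g) = subuniverse U-bridge f x y z w (λ i → go (g i))
    go (replace₁ a g r)    = B0₁ U-bridge _ _ _ _ a (go g) r
    go (replace₂ a g r)    = B0₂ U-bridge _ _ _ _ a (go g) r
    go (replace₃ a g r)    = B0₃ U-bridge _ _ _ _ a (go g) r
    go (replace₄ a g r)    = B0₄ U-bridge _ _ _ _ a (go g) r

  -- Bridgehood is a local property of Generated S: the projections and (B2*) are checked
  -- tuple by tuple, everything else holds by construction.
  Generated-bridge : ∀ {S} →
    (∀ {a b c d} → Generated S a b c d → ∃[ U ] (Bridge U × U a b c d)) → Bridge (Generated S)
  Generated-bridge {S} local = bridge , pr₁₂≐L , pr₃₄≐L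
    where
    pr₁₂≐L : pr₁₂ A (Generated S) ≐₂ L
    pr₁₂≐L = (λ { a b (_ , _ , g) → pr₁₂⊆L (local g) }) , λ a b l → a , b , diagonal l
      where
      pr₁₂⊆L : ∀ {a b c d} → ∃[ U ] (Bridge U × U a b c d) → L a b
      pr₁₂⊆L (U , (_ , U₁₂ , _) , u) = proj₁ U₁₂ _ _ (_ , _ , u)

    pr₃₄≐L : pr₃₄ A (Generated S) ≐₂ L
    pr₃₄≐L = (λ { c d (_ , _ , g) → pr₃₄⊆L (local g) }) , λ a b l → a , b , diagonal l
      where
      pr₃₄⊆L : ∀ {a b c d} → ∃[ U ] (Bridge U × U a b c d) → L c d
      pr₃₄⊆L (U , (_ , _ , U₃₄) , u) = proj₁ U₃₄ _ _ (_ , _ , u)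

    ρ-forward : ∀ {a b c d} → ∃[ U ] (Bridge U × U a b c d) → ρ a b → ρ c d
    ρ-forward (U , (U-bridge , _) , u) = B2⇒ U-bridge _ _ _ _ u

    ρ-backward : ∀ {a b c d} → ∃[ U ] (Bridge U × U a b c d) → ρ c d → ρ a b
    ρ-backward (U , (U-bridge , _) , u) = B2⇐ U-bridge _ _ _ _ u

    bridge : IsBridge A ρ (Generated S)
    bridge = record
      { subuniverse = apply
      ; B0₁ = λ _ _ _ _ → replace₁
      ; B0₂ = λ _ _ _ _ → replace₂
      ; B0₃ = λ _ _ _ _ → replace₃
      ; B0₄ = λ _ _ _ _ → replace₄
      ; B1₁₂ = ⊂-⊆-trans ρ⊂L (proj₂ pr₁₂≐L)
      ; B1₃₄ = ⊂-⊆-trans ρ⊂L (proj₂ pr₃₄≐L)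
      ; B2⇒ = λ _ _ _ _ g → ρ-forward (local g)
      ; B2⇐ = λ _ _ _ _ g → ρ-backward (local g)
      }

  Singleton : Carrier → Carrier → Rel₂ A
  Singleton a b x y = x ≡ a × y ≡ b

  -- The union of all reflexive traces would quantify over Rel₄ A and so land in Set₁;
  -- membership of (a,b) is instead expressed by the small proposition below.
  Opt : Rel₂ A
  Opt a b = Bridge (Generated (Singleton a b))

  tr⊆Opt : ∀ T → Bridge T → IsReflexive A T → tr A T ⊆₂ Opt
  tr⊆Opt T T-bridge T-refl a b t =
    Generated-bridge λ g → T ⨾ T ᵀ , TTᵀ-bridge ,
      Generated-least (proj₁ TTᵀ-bridge) (⨾ᵀ-diagonal T-bridge) ab∈trTTᵀ g
    where
    TTᵀ-bridge : Bridge (T ⨾ T ᵀ)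
    TTᵀ-bridge = ⨾-bridge T-bridge (ᵀ-bridge T-bridge)

    ab∈trTTᵀ : Singleton a b ⊆₂ tr A (T ⨾ T ᵀ)
    ab∈trTTᵀ _ _ (refl , refl) = tr-⨾ {T} {T ᵀ} t (T-refl b)

  Generated-Opt-local : ∀ {a b c d} → Generated Opt a b c d →
    ∃[ U ] (DiagonalBridge U × U a b c d)
  Generated-Opt-local (diagonal l) =
    Canonical , (canonical-bridge , canonical-diagonal) , canonical-diagonal _ _ l
  Generated-Opt-local (generator o) =
    Generated (Singleton _ _) , (o , λ _ _ → diagonal) , generator (refl , refl)
  Generated-Opt-local (apply f x y z w g)
    with common-diagonal-bridge (arity f) (proj₁ ∘ local) (proj₁ ∘ proj₂ ∘ local)
    where local = λ i → Generated-Opt-local (g i)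
  ... | V , V-db , U⊆V =
    V , V-db , subuniverse (proj₁ (proj₁ V-db)) f x y z w
                 (λ i → U⊆V i (proj₂ (proj₂ (Generated-Opt-local (g i)))))
  Generated-Opt-local (replace₁ a g r) with Generated-Opt-local g
  ... | U , U-db , u = U , U-db , B0₁ (proj₁ (proj₁ U-db)) _ _ _ _ a u r
  Generated-Opt-local (replace₂ a g r) with Generated-Opt-local g
  ... | U , U-db , u = U , U-db , B0₂ (proj₁ (proj₁ U-db)) _ _ _ _ a u r
  Generated-Opt-local (replace₃ a g r) with Generated-Opt-local g
  ... | U , U-db , u = U , U-db , B0₃ (proj₁ (proj₁ U-db)) _ _ _ _ a u r
  Generated-Opt-local (replace₄ a g r) with Generated-Opt-local g
  ... | U , U-db , u = U , U-db , B0₄ (proj₁ (proj₁ U-db)) _ _ _ _ a u r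

  Generated-Opt-bridge : Bridge (Generated Opt)
  Generated-Opt-bridge = Generated-bridge λ g →
    let U , (U-bridge , _) , u = Generated-Opt-local g in U , U-bridge , u

  tr-Generated-Opt⊆Opt : tr A (Generated Opt) ⊆₂ Opt
  tr-Generated-Opt⊆Opt = tr⊆Opt (Generated Opt) Generated-Opt-bridge Generated-reflexive

  Opt-greatest : IsGreatestIn (RefTr A ρ L) Opt
  Opt-greatest = Opt∈RefTr , λ S S∈RefTr → RefTr⊆Opt S∈RefTr
    where
    Opt∈RefTr : RefTr A ρ L Opt
    Opt∈RefTr = Generated Opt , Generated-Opt-bridge , Generated-reflexive
              , (λ _ _ → generator) , tr-Generated-Opt⊆Opt

    RefTr⊆Opt : ∀ {S} → RefTr A ρ L S → S ⊆₂ Opt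
    RefTr⊆Opt (T , T-bridge , T-refl , S⊆trT , _) a b s =
      tr⊆Opt T T-bridge T-refl a b (S⊆trT a b s)

  ρ⊆Opt : ρ ⊆₂ Opt
  ρ⊆Opt a b r =
    tr⊆Opt Canonical canonical-bridge canonical-reflexive a b (ρ⊆tr-canonical a b r)

  Opt-congruence : IsCongruence A Opt
  Opt-congruence = record
    { refl' = λ a → ρ⊆Opt a a (refl' a)
    ; sym' = λ a b o → tr⊆Opt (G ᵀ) (ᵀ-bridge G-bridge) G-reflexive b a (generator o)
    ; trans' = λ a b c o o′ →
        tr⊆Opt (G ⨾ G) (⨾-bridge G-bridge G-bridge) (⨾-reflexive {G} {G} G-reflexive G-reflexive)
          a c (tr-⨾ {G} {G} (generator o) (generator o′))
    ; compatible = λ f x y o → tr-Generated-Opt⊆Opt _ _ (apply f x x y y (generator ∘ o))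
    }
    where
    G = Generated Opt
    G-bridge = Generated-Opt-bridge

    G-reflexive : IsReflexive A G
    G-reflexive = Generated-reflexive

lemma4p11 : (𝔸 : FiniteAlgebra) →
    let A = FiniteAlgebra.algebra 𝔸 in
    (ρ : Rel₂ A) → IsCongruence A ρ → ¬ (_≐_ A ρ (full A)) →
    (L : Rel₂ A) → InCov A ρ L →
    Σ (Rel₂ A) λ Opt →
      IsMaximalIn A (RefTr A ρ L) Opt ×
      ((M : Rel₂ A) → IsMaximalIn A (RefTr A ρ L) M → _≐_ A M Opt) ×
      _⊆_ A ρ Opt × IsCongruence A Opt
lemma4p11 𝔸 ρ ρ-congruence _ L (L-saturated , ρ⊂L , _) =
  Opt , greatest⇒maximal Opt-greatest , (λ _ → maximal≐greatest Opt-greatest) ,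
  ρ⊆Opt , Opt-congruence
  where
  open Relations (FiniteAlgebra.algebra 𝔸)
  open OptimalTrace (FiniteAlgebra.algebra 𝔸) ρ ρ-congruence L L-saturated ρ⊂L
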